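{- Let $G_8$ be the graph with vertices $x,y,u_0,u_1,u_2,v_0,v_1$ and edges $xu_2,u_2u_1,u_2v_0,u_1u_0,u_0v_0,u_0v_1,v_0v_1,v_1y$. If $\varphi$ is a conflict-free incidence coloring of $G_8$ using at most $6$ colors, then $\{\varphi(u_2,u_2x),\varphi(x,u_2x)\}\cap\{\varphi(v_1,v_1y),\varphi(y,v_1y)\}=\emptyset$.
   Context: An incidence of a graph is a pair $(a,e)$ with $a$ an endpoint of the edge $e$; for a vertex $c$, $I(c)$ is the set of incidences $(b,e)$ with $e$ incident with $c$; two incidences conflict if both lie in some $I(c)$; a conflict-free incidence coloring assigns colors to incidences so that conflicting incidences get distinct colors. -}

module Defs where

open import Data.Bool using (Bool; true; false)
open import Data.Fin using (Fin)
open import Data.Product using (Σ; _×_; _,_; ∃)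
open import Relation.Binary.PropositionalEquality using (_≡_)
open import Relation.Nullary using (¬_)

data V : Set where
  x y u0 u1 u2 v0 v1 : V

data E : Set where
  xu2 u2u1 u2v0 u1u0 u0v0 u0v1 v0v1 v1y : E

end : E → Bool → V
end xu2  true = x
end xu2  false = u2
end u2u1 true = u2
end u2u1 false = u1
end u2v0 true = u2
end u2v0 false = v0
end u1u0 true = u1
end u1u0 false = u0
end u0v0 true = u0
end u0v0 false = v0
end u0v1 true = u0
end u0v1 false = v1
end v0v1 true = v0
end v0v1 false = v1
end v1y  true = v1
end v1y  false = y

IncidentWith : V → E → Set
IncidentWith c e = Σ Bool λ s → end e s ≡ c

Incidence : Set
Incidence = Σ V λ a → Σ E λ e → IncidentWith a e

vert : Incidence → V
vert (a , _ , _) = a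

edge : Incidence → E
edge (_ , e , _) = e

InI : V → Incidence → Set
InI c i = IncidentWith c (edge i)

Conflict : Incidence → Incidence → Set
Conflict i j = Σ V λ c → InI c i × InI c j

-- incidences are identified by (vertex, edge)
SameIncidence : Incidence → Incidence → Set
SameIncidence i j = (vert i ≡ vert j) × (edge i ≡ edge j)

ConflictFree : {k : _} → (Incidence → Fin k) → Set
ConflictFree φ = ∀ i j → ¬ SameIncidence i j → Conflict i j → ¬ (φ i ≡ φ j)

inc : (a : V) (e : E) → IncidentWith a e → Incidence
inc a e p = a , e , p

-- A vertex of degree three has six pairwise conflicting incidences, so with six colours
-- every colour appears at it. Let c colour an incidence of xu2 and one of v1y. At v0, c can
-- be on neither u2v0 (adjacent to xu2) nor v0v1 (adjacent to v1y), so c is on u0v0. Also at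
-- v0, the colours of u0v1 avoid u0v0 and v0v1, so they are on u2v0; hence at u0 the colours
-- of u2u1 avoid u1u0 and u0v1, so they too are on u0v0. But c and the two colours of u2u1
-- are pairwise distinct, and an edge carries only two colours.
module Submission where

open import Defs
open import Data.Bool using (Bool; true; false)
open import Data.Empty using (⊥; ⊥-elim)
open import Data.Fin using (Fin; zero; suc; remQuot; combine; _≟_)
open import Data.Fin.Properties using (pigeonhole; <-irrefl; combine-remQuot)
open import Data.Nat using (_*_)
open import Data.Nat.Properties using (n<1+n)
open import Data.Product using (∃; _×_; _,_; uncurry)
open import Data.Sum using (_⊎_; inj₁; inj₂; [_,_]′)
open import Data.Vec.Functional using (_∷_)
open import Function using (_∘_)
open import Function.Definitions using (Injective)
open import Relation.Binary.PropositionalEquality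
  using (_≡_; _≢_; refl; sym; trans; cong; cong₂; module ≡-Reasoning)
open import Relation.Nullary using (¬_; yes; no)

injective⇒surjective : ∀ {n} (f : Fin n → Fin n) → Injective _≡_ _≡_ f →
                       ∀ c → ∃ λ i → f i ≡ c
injective⇒surjective {n} f f-injective c with pigeonhole (n<1+n n) (c ∷ f)
... | zero  , suc j , _   , c≡fj  = j , sym c≡fj
... | suc i , suc j , i<j , fi≡fj = ⊥-elim (<-irrefl (cong suc (f-injective fi≡fj)) i<j)

remQuot-injective : ∀ {m} n {i j : Fin (m * n)} → remQuot {m} n i ≡ remQuot n j → i ≡ j
remQuot-injective {m} n {i} {j} eq = begin
  i                                 ≡⟨ combine-remQuot {m} n i ⟨
  uncurry combine (remQuot {m} n i) ≡⟨ cong (uncurry combine) eq ⟩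
  uncurry combine (remQuot {m} n j) ≡⟨ combine-remQuot {m} n j ⟩
  j                                 ∎
  where open ≡-Reasoning

_at_ : E → Bool → Incidence
e at s = end e s , e , s , refl

loopless : ∀ e → end e true ≢ end e false
loopless xu2  ()
loopless u2u1 ()
loopless u2v0 ()
loopless u1u0 ()
loopless u0v0 ()
loopless u0v1 ()
loopless v0v1 ()
loopless v1y  ()

at-injective : ∀ {e f s t} → SameIncidence (e at s) (f at t) → e ≡ f × s ≡ t
at-injective     {s = true}  {true}  (_     , refl) = refl , refl
at-injective     {s = false} {false} (_     , refl) = refl , refl
at-injective {e} {s = true}  {false} (ends≡ , refl) = ⊥-elim (loopless e ends≡)
at-injective {e} {s = false} {true}  (ends≡ , refl) = ⊥-elim (loopless e (sym ends≡))

_∈_[_] : {A : Set} → A → (Incidence → A) → E → Set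
c ∈ φ [ e ] = ∃ λ s → c ≡ φ (e at s)

at-most-two-colours : ∀ {A : Set} {φ : Incidence → A} {e a b d} →
                      a ∈ φ [ e ] → b ∈ φ [ e ] → d ∈ φ [ e ] → a ≢ b → a ≢ d → b ≢ d → ⊥
at-most-two-colours (true  , a≡) (true  , b≡) _            a≢b _   _   = a≢b (trans a≡ (sym b≡))
at-most-two-colours (false , a≡) (false , b≡) _            a≢b _   _   = a≢b (trans a≡ (sym b≡))
at-most-two-colours (true  , a≡) (false , _)  (true  , d≡) _   a≢d _   = a≢d (trans a≡ (sym d≡))
at-most-two-colours (false , a≡) (true  , _)  (false , d≡) _   a≢d _   = a≢d (trans a≡ (sym d≡))
at-most-two-colours (true  , _)  (false , b≡) (false , d≡) _   _   b≢d = b≢d (trans b≡ (sym d≡))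
at-most-two-colours (false , _)  (true  , b≡) (true  , d≡) _   _   b≢d = b≢d (trans b≡ (sym d≡))

module _ {k} {φ : Incidence → Fin k} (cf : ConflictFree φ) where

  ends-coloured-differently : ∀ e → φ (e at true) ≢ φ (e at false)
  ends-coloured-differently e =
    cf (e at true) (e at false) (λ (ends≡ , _) → loopless e ends≡)
       (end e true , (true , refl) , (true , refl))

  ∉-adjacent : ∀ {w} e f {c} → e ≢ f → IncidentWith w e → IncidentWith w f →
               c ∈ φ [ e ] → ¬ c ∈ φ [ f ]
  ∉-adjacent {w} e f e≢f w∈e w∈f (s , c≡) (t , c≡′) =
    cf (e at s) (f at t) (λ (_ , e≡f) → e≢f e≡f) (w , w∈e , w∈f) (trans (sym c≡) c≡′)

module _ {φ : Incidence → Fin 6} (cf : ConflictFree φ) {w : V} (e₁ e₂ e₃ : E)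
         (w∈e₁ : IncidentWith w e₁) (w∈e₂ : IncidentWith w e₂) (w∈e₃ : IncidentWith w e₃)
         (e₁≢e₂ : e₁ ≢ e₂) (e₁≢e₃ : e₁ ≢ e₃) (e₂≢e₃ : e₂ ≢ e₃) where

  private
    star : Fin 3 → E
    star zero             = e₁
    star (suc zero)       = e₂
    star (suc (suc zero)) = e₃

    w∈star : ∀ j → IncidentWith w (star j)
    w∈star zero             = w∈e₁
    w∈star (suc zero)       = w∈e₂
    w∈star (suc (suc zero)) = w∈e₃

    star-injective : Injective _≡_ _≡_ star
    star-injective {zero}           {zero}           _  = refl
    star-injective {zero}           {suc zero}       eq = ⊥-elim (e₁≢e₂ eq)
    star-injective {zero}           {suc (suc zero)} eq = ⊥-elim (e₁≢e₃ eq)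
    star-injective {suc zero}       {zero}           eq = ⊥-elim (e₁≢e₂ (sym eq))
    star-injective {suc zero}       {suc zero}       _  = refl
    star-injective {suc zero}       {suc (suc zero)} eq = ⊥-elim (e₂≢e₃ eq)
    star-injective {suc (suc zero)} {zero}           eq = ⊥-elim (e₁≢e₃ (sym eq))
    star-injective {suc (suc zero)} {suc zero}       eq = ⊥-elim (e₂≢e₃ (sym eq))
    star-injective {suc (suc zero)} {suc (suc zero)} _  = refl

    side : Fin 2 → Bool
    side zero       = true
    side (suc zero) = false

    side-injective : Injective _≡_ _≡_ side
    side-injective {zero}     {zero}     _  = refl
    side-injective {suc zero} {suc zero} _  = refl
    side-injective {zero}     {suc zero} ()
    side-injective {suc zero} {zero}     ()

    slot : Fin 3 × Fin 2 → Incidence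
    slot (j , s) = star j at side s

    slot-injective : ∀ {p q} → SameIncidence (slot p) (slot q) → p ≡ q
    slot-injective same with at-injective same
    ... | star≡ , side≡ = cong₂ _,_ (star-injective star≡) (side-injective side≡)

    colour : Fin 6 → Fin 6
    colour = φ ∘ slot ∘ remQuot 2

    colour-injective : Injective _≡_ _≡_ colour
    colour-injective {i} {j} colour≡ with i ≟ j
    ... | yes i≡j = i≡j
    ... | no  i≢j = ⊥-elim (cf (slot (remQuot 2 i)) (slot (remQuot 2 j))
                              (i≢j ∘ remQuot-injective 2 ∘ slot-injective)
                              (w , w∈star _ , w∈star _) colour≡)

    on-star : ∀ {c} p → φ (slot p) ≡ c → c ∈ φ [ e₁ ] ⊎ c ∈ φ [ e₂ ] ⊎ c ∈ φ [ e₃ ]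
    on-star (zero           , s) φ≡c = inj₁ (side s , sym φ≡c)
    on-star (suc zero       , s) φ≡c = inj₂ (inj₁ (side s , sym φ≡c))
    on-star (suc (suc zero) , s) φ≡c = inj₂ (inj₂ (side s , sym φ≡c))

  every-colour-at-degree-three : ∀ c → c ∈ φ [ e₁ ] ⊎ c ∈ φ [ e₂ ] ⊎ c ∈ φ [ e₃ ]
  every-colour-at-degree-three c with injective⇒surjective colour colour-injective c
  ... | i , colour≡c = on-star (remQuot 2 i) colour≡c

  colour-on-third-edge : ∀ {c} → ¬ c ∈ φ [ e₁ ] → ¬ c ∈ φ [ e₂ ] → c ∈ φ [ e₃ ]
  colour-on-third-edge {c} c∉e₁ c∉e₂ with every-colour-at-degree-three c
  ... | inj₁ c∈e₁        = ⊥-elim (c∉e₁ c∈e₁)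
  ... | inj₂ (inj₁ c∈e₂) = ⊥-elim (c∉e₂ c∈e₂)
  ... | inj₂ (inj₂ c∈e₃) = c∈e₃

module _ {φ : Incidence → Fin 6} (cf : ConflictFree φ) where

  u0v1-colours-on-u2v0 : ∀ s → φ (u0v1 at s) ∈ φ [ u2v0 ]
  u0v1-colours-on-u2v0 s =
    colour-on-third-edge cf u0v0 v0v1 u2v0 (false , refl) (true , refl) (false , refl)
      (λ ()) (λ ()) (λ ())
      (∉-adjacent cf u0v1 u0v0 (λ ()) (true , refl) (true , refl) (s , refl))
      (∉-adjacent cf u0v1 v0v1 (λ ()) (false , refl) (false , refl) (s , refl))

  u2u1-colours-on-u0v0 : ∀ s → φ (u2u1 at s) ∈ φ [ u0v0 ]
  u2u1-colours-on-u0v0 s =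
    colour-on-third-edge cf u1u0 u0v1 u0v0 (false , refl) (true , refl) (true , refl)
      (λ ()) (λ ()) (λ ())
      (∉-adjacent cf u2u1 u1u0 (λ ()) (false , refl) (true , refl) (s , refl))
      (λ (t , u2u1≡u0v1) → ∉-adjacent cf u2v0 u2u1 (λ ()) (true , refl) (true , refl)
                             (u0v1-colours-on-u2v0 t) (s , sym u2u1≡u0v1))

lemma3p6 : (φ : Incidence → Fin 6) → ConflictFree φ →
    (c : Fin 6) →
    (c ≡ φ (inc u2 xu2 (false , refl)) ⊎ c ≡ φ (inc x xu2 (true , refl))) →
    (c ≡ φ (inc v1 v1y (true , refl)) ⊎ c ≡ φ (inc y v1y (false , refl))) →
    ⊥
lemma3p6 φ cf c c-at-xu2 c-at-v1y =
  at-most-two-colours {φ = φ} c∈u0v0 (u2u1-colours-on-u0v0 cf true) (u2u1-colours-on-u0v0 cf false)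
    (c∉u2u1 true) (c∉u2u1 false) (ends-coloured-differently cf u2u1)
  where
  c∈xu2 : c ∈ φ [ xu2 ]
  c∈xu2 = [ (false ,_) , (true ,_) ]′ c-at-xu2

  c∈v1y : c ∈ φ [ v1y ]
  c∈v1y = [ (true ,_) , (false ,_) ]′ c-at-v1y

  c∉u2u1 : ∀ s → c ≢ φ (u2u1 at s)
  c∉u2u1 s c≡ = ∉-adjacent cf xu2 u2u1 (λ ()) (false , refl) (true , refl) c∈xu2 (s , c≡)

  c∈u0v0 : c ∈ φ [ u0v0 ]
  c∈u0v0 =
    colour-on-third-edge cf u2v0 v0v1 u0v0 (false , refl) (true , refl) (false , refl)
      (λ ()) (λ ()) (λ ())
      (∉-adjacent cf xu2 u2v0 (λ ()) (false , refl) (true , refl) c∈xu2)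
      (∉-adjacent cf v1y v0v1 (λ ()) (true , refl) (false , refl) c∈v1y)
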